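{- Let $c\geq 2$, $\mathcal{C}=\{1,2c\}$, and let $n$ be a positive integer such that $\mathcal{G}_{\mathcal{C}}(m)=s_c(m)$ for all $1\leq m\leq n$. Let $p\geq 2$. If $O_{n+1}=(h_1,\dots,h_p)$ is a partition of $n+1$ into $p$ parts that is not an entering partition, then there is a partition $O'_n$ of $n$ into $p$ parts with $\mathcal{G}(O_{n+1})=\mathcal{G}(O'_n)\oplus 1$. Similarly, if $O_n=(j_1,\dots,j_p)$ is a partition of $n$ into $p$ parts that is not an exiting partition, then there is a partition $O'_{n+1}$ of $n+1$ into $p$ parts with $\mathcal{G}(O'_{n+1})=\mathcal{G}(O_n)\oplus 1$.
   Context: $\mathcal{G}_{\mathcal{C}}$ is the nim-sequence of \textsc{cut} with cut-set $\mathcal{C}$: $\mathcal{G}_{\mathcal{C}}(n)=\operatorname{mex}\{\mathcal{G}_{\mathcal{C}}(h_0)\oplus\cdots\oplus\mathcal{G}_{\mathcal{C}}(h_d): d\in\mathcal{C}, h_i\geq 1, \sum h_i=n\}$, with $\oplus$ bitwise XOR and mex the least nonnegative integer not in the set. A partition of $n$ into $p$ parts is a tuple $(h_1,\dots,h_p)$ of positive integers summing to $n$; its nim-value is $\mathcal{G}((h_1,\dots,h_p))=\mathcal{G}_{\mathcal{C}}(h_1)\oplus\cdots\oplus\mathcal{G}_{\mathcal{C}}(h_p)$. The sequence $s_c$: for $n=12cq+m$, $q\ge0$, $1\le m\le 12c$, $s_c(n)=8q+t(m)$ with $t(m)=0/1$ for $1\le m\le 2c$ ($m$ odd/even), $2/3$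 for $2c<m\le 4c$ (odd/even), $t(4c+1)=1$, $5/4$ for $4c+2\le m\le 6c$ (odd/even), $3/2$ for $6c<m\le 8c$ (odd/even), $4/5$ for $8c<m\le 10c$ (odd/even), $6/7$ for $10c<m\le 12c$ (odd/even). An innumber is a positive integer $\equiv 1 \pmod{2c}$ or $\equiv 4c+2 \pmod{12c}$; an outnumber is a positive integer $\equiv 0 \pmod{2c}$ or $\equiv 4c+1 \pmod{12c}$. A partition is entering if all its parts are innumbers and exiting if all its parts are outnumbers. -}

module Defs where

open import Data.Nat using (ℕ; zero; suc; _+_; _*_; _∸_; _≤_; _<_; _≤ᵇ_; _≡ᵇ_)
open import Data.Nat.DivMod using (_/_; _%_)
open import Data.Bool using (Bool; true; false; if_then_else_; not)
open import Data.Vec using (Vec; foldr; map)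
open import Data.Vec.Relation.Unary.All using (All)
open import Data.Product using (Σ; ∃; _×_)
open import Data.Sum using (_⊎_)
open import Relation.Binary.PropositionalEquality using (_≡_)
open import Relation.Nullary using (¬_)

-- Bitwise XOR on ℕ (nim-sum).  Defined bit by bit with fuel; fuel a + b
-- exceeds the bit-length of both arguments, so the result is exact.

xorFuel : ℕ → ℕ → ℕ → ℕ
xorFuel zero    a b = 0
xorFuel (suc f) a b =
  (if (a % 2) ≡ᵇ (b % 2) then 0 else 1) + 2 * xorFuel f (a / 2) (b / 2)

_⊕_ : ℕ → ℕ → ℕ
a ⊕ b = xorFuel (a + b) a b

infixl 6 _⊕_

⊕-sum : ∀ {k} → Vec ℕ k → ℕ
⊕-sum = foldr _ _⊕_ 0

IsPartition : (n p : ℕ) → Vec ℕ p → Set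
IsPartition n p h = All (λ x → 1 ≤ x) h × foldr _ _+_ 0 h ≡ n

nimVal : (ℕ → ℕ) → ∀ {p} → Vec ℕ p → ℕ
nimVal g h = ⊕-sum (map g h)

InCutSet : ℕ → ℕ → Set
InCutSet c d = d ≡ 1 ⊎ d ≡ 2 * c

-- v is the nim-value of some option of a heap of size n in CUT with
-- cut-set {1,2c}: cutting into d+1 positive parts, d ∈ C.
IsOption : (c : ℕ) → (ℕ → ℕ) → ℕ → ℕ → Set
IsOption c g n v =
  Σ ℕ λ d → InCutSet c d ×
    Σ (Vec ℕ (suc d)) λ h → IsPartition n (suc d) h × nimVal g h ≡ v

-- g is the nim-sequence G_C of CUT with C = {1,2c}:
-- for every n ≥ 1, g n = mex { option values of n }.
-- (The value at 0 is irrelevant and unconstrained.)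
IsNimSeq : ℕ → (ℕ → ℕ) → Set
IsNimSeq c g =
  ∀ n → 1 ≤ n →
    (¬ IsOption c g n (g n)) × (∀ v → v < g n → IsOption c g n v)

-- The sequence s_c.  For c = 0 it is junk (only c ≥ 2 is used).

odd? : ℕ → Bool
odd? m = (m % 2) ≡ᵇ 1

oe : ℕ → ℕ → ℕ → ℕ
oe m a b = if odd? m then a else b

tval : ℕ → ℕ → ℕ
tval c m =
  if m ≤ᵇ 2 * c then oe m 0 1 else
  if m ≤ᵇ 4 * c then oe m 2 3 else
  if m ≡ᵇ 4 * c + 1 then 1 else
  if m ≤ᵇ 6 * c then oe m 5 4 else
  if m ≤ᵇ 8 * c then oe m 3 2 else
  if m ≤ᵇ 10 * c then oe m 4 5 else
  oe m 6 7

-- n = 12cq + m with q ≥ 0, 1 ≤ m ≤ 12c, i.e. q = (n-1)/(12c),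
-- m = (n-1) mod 12c + 1   (for n ≥ 1).
s : ℕ → ℕ → ℕ
s zero    n = 0
s (suc k) n =
  8 * ((n ∸ 1) / (12 * suc k)) + tval (suc k) ((n ∸ 1) % (12 * suc k) + 1)

IsInnumber : ℕ → ℕ → Set
IsInnumber c x =
  1 ≤ x × ((∃ λ k → x ≡ k * (2 * c) + 1) ⊎ (∃ λ k → x ≡ k * (12 * c) + (4 * c + 2)))

IsOutnumber : ℕ → ℕ → Set
IsOutnumber c x =
  1 ≤ x × ((∃ λ k → x ≡ k * (2 * c)) ⊎ (∃ λ k → x ≡ k * (12 * c) + (4 * c + 1)))

IsEntering : ℕ → ∀ {p} → Vec ℕ p → Set
IsEntering c h = All (IsInnumber c) h

IsExiting : ℕ → ∀ {p} → Vec ℕ p → Set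
IsExiting c h = All (IsOutnumber c) h

{-# OPTIONS --safe #-}
-- Call a and b siblings when they differ only in the lowest bit. Replacing one summand of a
-- nim-sum by a sibling replaces the nim-sum by a sibling. By the explicit formula, s_c(y+1) and
-- s_c(y) are siblings for y ≥ 1 unless y is an outnumber, and then y+1 is an innumber. As p ≥ 2,
-- every part of a partition of n+1 is at most n, where 𝒢 agrees with s_c: a part of O_{n+1}
-- that is not an innumber can be lowered by one, and dually a part of O_n that is not an
-- outnumber can be raised by one.
module Submission where

open import Defs
open import Data.Nat using (ℕ; _≤_)
open import Data.Vec using (Vec)
open import Data.Product using (Σ; _×_)
open import Relation.Binary.PropositionalEquality using (_≡_)
open import Relation.Nullary using (¬_)
open import Data.Nat
  using (zero; suc; _+_; _*_; _<_; _≤′_; _≡ᵇ_; _≤ᵇ_; z≤n; s≤s; ≤′-refl; ≤′-step)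
open import Data.Nat.Properties
open import Data.Nat.DivMod
  using (_/_; _%_; m*n%n≡0; m*n/n≡m; [m+kn]%n≡m%n; +-distrib-/-∣ʳ; m<n⇒m%n≡m; m<n⇒m/n≡0;
         m≡m%n+[m/n]*n; m%n<n)
open import Data.Nat.Divisibility using (divides-refl)
open import Data.Nat.Tactic.RingSolver using (solve-∀)
open import Data.Bool using (true; false; if_then_else_; T)
open import Data.Bool.Properties using (T-≡; ¬-not)
open import Data.Vec using ([]; _∷_; sum)
open import Data.Vec.Relation.Unary.All as All using (All; []; _∷_)
open import Data.Vec.Relation.Unary.Any using (Any; here; there)
open import Data.Product using (_,_; ∃)
open import Data.Empty using (⊥-elim)
open import Data.Sum using (_⊎_; inj₁; inj₂) renaming (map to ⊎-map; map₂ to ⊎-map₂)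
open import Function.Bundles using (Equivalence)
open import Relation.Binary.PropositionalEquality
  using (_≢_; ≢-sym; refl; sym; trans; cong; cong₂; subst; subst₂; module ≡-Reasoning)
open import Relation.Binary.Definitions using (tri<; tri≈; tri>)
open import Relation.Nullary using (yes; no)

data EvenOrOdd : ℕ → Set where
  even : ∀ k → EvenOrOdd (2 * k)
  odd  : ∀ k → EvenOrOdd (suc (2 * k))

evenOrOdd : ∀ n → EvenOrOdd n
evenOrOdd zero = even 0
evenOrOdd (suc n) with evenOrOdd n
... | even k = odd k
... | odd k  = subst EvenOrOdd (*-suc 2 k) (even (suc k))

module _ {n : ℕ} where

  bit : EvenOrOdd n → ℕ
  bit (even k) = 0
  bit (odd k)  = 1

  half : EvenOrOdd n → ℕ
  half (even k) = k
  half (odd k)  = k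

  %2≡bit : (v : EvenOrOdd n) → n % 2 ≡ bit v
  %2≡bit (even k) = trans (cong (_% 2) (*-comm 2 k)) (m*n%n≡0 k 2)
  %2≡bit (odd k)  = trans (cong (λ m → suc m % 2) (*-comm 2 k)) ([m+kn]%n≡m%n 1 k 2)

  /2≡half : (v : EvenOrOdd n) → n / 2 ≡ half v
  /2≡half (even k) = trans (cong (_/ 2) (*-comm 2 k)) (m*n/n≡m k 2)
  /2≡half (odd k)  = trans (cong (λ m → suc m / 2) (*-comm 2 k))
                           (trans (+-distrib-/-∣ʳ 1 {d = 2} (divides-refl k)) (m*n/n≡m k 2))

  2*half≤ : (v : EvenOrOdd n) → 2 * half v ≤ n
  2*half≤ (even k) = ≤-refl
  2*half≤ (odd k)  = n≤1+n (2 * k)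

2*m≤1+n⇒m≤n : ∀ {m n} → 2 * m ≤ suc n → m ≤ n
2*m≤1+n⇒m≤n {m} {n} 2m≤1+n =
  ≤-pred (*-cancelˡ-< 2 m (suc n) (≤-<-trans 2m≤1+n (m<m+n (suc n) (s≤s z≤n))))

half+half≤ : ∀ {a b f} (va : EvenOrOdd a) (vb : EvenOrOdd b) → a + b ≤ suc f → half va + half vb ≤ f
half+half≤ {a} {b} {f} va vb a+b≤1+f = 2*m≤1+n⇒m≤n (begin
  2 * (half va + half vb)    ≡⟨ *-distribˡ-+ 2 (half va) (half vb) ⟩
  2 * half va + 2 * half vb  ≤⟨ +-mono-≤ (2*half≤ va) (2*half≤ vb) ⟩
  a + b                      ≤⟨ a+b≤1+f ⟩
  suc f                      ∎)
  where open ≤-Reasoning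

odd?-even : ∀ k → odd? (2 * k) ≡ false
odd?-even k = cong (_≡ᵇ 1) (%2≡bit (even k))

odd?-odd : ∀ k → odd? (suc (2 * k)) ≡ true
odd?-odd k = cong (_≡ᵇ 1) (%2≡bit (odd k))

bitXor : ∀ {a b} → EvenOrOdd a → EvenOrOdd b → ℕ
bitXor va vb = if bit va ≡ᵇ bit vb then 0 else 1

bitXor-comm : ∀ {a b} (va : EvenOrOdd a) (vb : EvenOrOdd b) → bitXor va vb ≡ bitXor vb va
bitXor-comm (even _) (even _) = refl
bitXor-comm (even _) (odd _)  = refl
bitXor-comm (odd _)  (even _) = refl
bitXor-comm (odd _)  (odd _)  = refl

xorFuel-suc : ∀ f {a b} (va : EvenOrOdd a) (vb : EvenOrOdd b) →
  xorFuel (suc f) a b ≡ bitXor va vb + 2 * xorFuel f (half va) (half vb)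
xorFuel-suc f va vb rewrite %2≡bit va | %2≡bit vb | /2≡half va | /2≡half vb = refl

xorFuel-stable : ∀ f a b → a + b ≤ f → xorFuel f a b ≡ xorFuel (suc f) a b
xorFuel-stable zero zero zero _ = refl
xorFuel-stable (suc f) a b a+b≤1+f = begin
  xorFuel (suc f) a b                                    ≡⟨ xorFuel-suc f va vb ⟩
  bitXor va vb + 2 * xorFuel f (half va) (half vb)       ≡⟨ cong (λ x → bitXor va vb + 2 * x) halves-stable ⟩
  bitXor va vb + 2 * xorFuel (suc f) (half va) (half vb) ≡⟨ xorFuel-suc (suc f) va vb ⟨
  xorFuel (suc (suc f)) a b                              ∎
  where
  open ≡-Reasoning
  va : EvenOrOdd a
  va = evenOrOdd a
  vb : EvenOrOdd b
  vb = evenOrOdd b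
  halves-stable : xorFuel f (half va) (half vb) ≡ xorFuel (suc f) (half va) (half vb)
  halves-stable = xorFuel-stable f (half va) (half vb) (half+half≤ va vb a+b≤1+f)

⊕≡xorFuel : ∀ {a b f} → a + b ≤ f → a ⊕ b ≡ xorFuel f a b
⊕≡xorFuel {a} {b} a+b≤f = go (≤⇒≤′ a+b≤f)
  where
  go : ∀ {f} → a + b ≤′ f → a ⊕ b ≡ xorFuel f a b
  go ≤′-refl       = refl
  go (≤′-step ≤f) = trans (go ≤f) (xorFuel-stable _ a b (≤′⇒≤ ≤f))

xorFuel-comm : ∀ f a b → xorFuel f a b ≡ xorFuel f b a
xorFuel-comm zero a b = refl
xorFuel-comm (suc f) a b = begin
  xorFuel (suc f) a b                                ≡⟨ xorFuel-suc f va vb ⟩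
  bitXor va vb + 2 * xorFuel f (half va) (half vb)   ≡⟨ cong₂ (λ x y → x + 2 * y) (bitXor-comm va vb) (xorFuel-comm f _ _) ⟩
  bitXor vb va + 2 * xorFuel f (half vb) (half va)   ≡⟨ xorFuel-suc f vb va ⟨
  xorFuel (suc f) b a                                ∎
  where
  open ≡-Reasoning
  va : EvenOrOdd a
  va = evenOrOdd a
  vb : EvenOrOdd b
  vb = evenOrOdd b

⊕-comm : ∀ a b → a ⊕ b ≡ b ⊕ a
⊕-comm a b = trans (xorFuel-comm (a + b) a b) (sym (⊕≡xorFuel (≤-reflexive (+-comm b a))))

xorFuel-identityʳ : ∀ f k → k ≤ f → xorFuel f k 0 ≡ k
xorFuel-identityʳ zero zero _ = refl
xorFuel-identityʳ (suc f) k k≤1+f with evenOrOdd k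
... | even j = trans (xorFuel-suc f (even j) (even 0)) (cong (2 *_) (xorFuel-identityʳ f j j≤f))
  where
  j≤f : j ≤ f
  j≤f = 2*m≤1+n⇒m≤n k≤1+f
... | odd j  = trans (xorFuel-suc f (odd j) (even 0)) (cong (λ x → suc (2 * x)) (xorFuel-identityʳ f j j≤f))
  where
  j≤f : j ≤ f
  j≤f = 2*m≤1+n⇒m≤n (≤-trans (n≤1+n (2 * j)) k≤1+f)

-- Sibling a b means a ≡ b ⊕ 1 (Sibling⇒≡⊕1); working with it instead of ⊕ 1 spares us the
-- associativity of the fuel-based XOR.
data Sibling : ℕ → ℕ → Set where
  even-odd : ∀ k → Sibling (2 * k) (suc (2 * k))
  odd-even : ∀ k → Sibling (suc (2 * k)) (2 * k)

Sibling-sym : ∀ {a b} → Sibling a b → Sibling b a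
Sibling-sym (even-odd k) = odd-even k
Sibling-sym (odd-even k) = even-odd k

Sibling-shift : ∀ k {a b} → Sibling a b → Sibling (2 * k + a) (2 * k + b)
Sibling-shift k (even-odd j) =
  subst₂ Sibling 2[k+j]≡ (trans (cong suc 2[k+j]≡) (sym (+-suc (2 * k) (2 * j)))) (even-odd (k + j))
  where
  2[k+j]≡ : 2 * (k + j) ≡ 2 * k + 2 * j
  2[k+j]≡ = *-distribˡ-+ 2 k j
Sibling-shift k (odd-even j) = Sibling-sym (Sibling-shift k (even-odd j))

xorFuel-siblingˡ : ∀ f {a a′} b → Sibling a a′ → Sibling (xorFuel (suc f) a b) (xorFuel (suc f) a′ b)
xorFuel-siblingˡ f b (even-odd k) rewrite xorFuel-suc f (even k) (evenOrOdd b) | xorFuel-suc f (odd k) (evenOrOdd b)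
  with evenOrOdd b
... | even j = even-odd (xorFuel f k j)
... | odd j  = odd-even (xorFuel f k j)
xorFuel-siblingˡ f b (odd-even k) = Sibling-sym (xorFuel-siblingˡ f b (even-odd k))

⊕-siblingˡ : ∀ {a a′} b → Sibling a a′ → Sibling (a ⊕ b) (a′ ⊕ b)
⊕-siblingˡ {a} {a′} b sib =
  subst₂ Sibling (sym (⊕≡xorFuel {a} {b} a+b≤)) (sym (⊕≡xorFuel {a′} {b} a′+b≤)) (xorFuel-siblingˡ (a + a′ + b) b sib)
  where
  a+b≤ : a + b ≤ suc (a + a′ + b)
  a+b≤ = m≤n⇒m≤1+n (+-monoˡ-≤ b (m≤m+n a a′))
  a′+b≤ : a′ + b ≤ suc (a + a′ + b)
  a′+b≤ = m≤n⇒m≤1+n (+-monoˡ-≤ b (m≤n+m a′ a))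

⊕-siblingʳ : ∀ a {b b′} → Sibling b b′ → Sibling (a ⊕ b) (a ⊕ b′)
⊕-siblingʳ a {b} {b′} sib = subst₂ Sibling (⊕-comm b a) (⊕-comm b′ a) (⊕-siblingˡ a sib)

Sibling⇒≡⊕1 : ∀ {a b} → Sibling a b → a ≡ b ⊕ 1
Sibling⇒≡⊕1 (even-odd k) = sym (begin
  suc (2 * k) ⊕ 1                             ≡⟨ ⊕≡xorFuel {suc (2 * k)} {1} (≤-reflexive (+-comm (suc (2 * k)) 1)) ⟩
  xorFuel (suc (suc (2 * k))) (suc (2 * k)) 1 ≡⟨ xorFuel-suc (suc (2 * k)) (odd k) (odd 0) ⟩
  2 * xorFuel (suc (2 * k)) k 0               ≡⟨ cong (2 *_) (xorFuel-identityʳ _ k (m≤n⇒m≤1+n (m≤m+n k (k + 0)))) ⟩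
  2 * k                                       ∎)
  where open ≡-Reasoning
Sibling⇒≡⊕1 (odd-even k) = sym (begin
  2 * k ⊕ 1                            ≡⟨ ⊕≡xorFuel {2 * k} {1} (≤-reflexive (+-comm (2 * k) 1)) ⟩
  xorFuel (suc (2 * k)) (2 * k) 1      ≡⟨ xorFuel-suc (2 * k) (even k) (odd 0) ⟩
  suc (2 * xorFuel (2 * k) k 0)        ≡⟨ cong (λ x → suc (2 * x)) (xorFuel-identityʳ _ k (m≤m+n k (k + 0))) ⟩
  suc (2 * k)                          ∎)
  where open ≡-Reasoning

≤ᵇ-true : ∀ {m n} → m ≤ n → (m ≤ᵇ n) ≡ true
≤ᵇ-true m≤n = Equivalence.to T-≡ (≤⇒≤ᵇ m≤n)

≤ᵇ-false : ∀ {m n} → n < m → (m ≤ᵇ n) ≡ false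
≤ᵇ-false {m} {n} n<m = ¬-not (λ m≤ᵇn → <⇒≱ n<m (≤ᵇ⇒≤ m n (Equivalence.from T-≡ m≤ᵇn)))

≡ᵇ-false : ∀ {m n} → m ≢ n → (m ≡ᵇ n) ≡ false
≡ᵇ-false {m} {n} m≢n = ¬-not (λ m≡ᵇn → m≢n (≡ᵇ⇒≡ m n (Equivalence.from T-≡ m≡ᵇn)))

oe-step : ∀ m {a b} → Sibling a b → Sibling (oe (suc m) a b) (oe m a b)
oe-step m sib with evenOrOdd m
... | even k rewrite odd?-odd k | odd?-even k = sib
... | odd k  rewrite trans (cong odd? (sym (*-suc 2 k))) (odd?-even (suc k)) | odd?-odd k = Sibling-sym sib

module _ {c : ℕ} (1≤c : 1 ≤ c) where

  Band : ℕ → ℕ → ℕ → ℕ → Set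
  Band lo hi a b = ∀ {m} → lo < m → m ≤ hi → tval c m ≡ oe m a b

  private
    above : ∀ i j {m} → T (i ≤ᵇ j) → j * c < m → i * c < m
    above i j i≤ᵇj = ≤-<-trans (*-monoˡ-≤ c (≤ᵇ⇒≤ i j i≤ᵇj))

    4c+1≤6c : 4 * c + 1 ≤ 6 * c
    4c+1≤6c = ≤-trans (+-monoʳ-≤ (4 * c) (≤-trans 1≤c (m≤m+n c (c + 0))))
                      (≤-reflexive (sym (*-distribʳ-+ c 4 2)))

    4c<4c+1 : 4 * c < 4 * c + 1
    4c<4c+1 = m<m+n (4 * c) (s≤s z≤n)

  tval-band₁ : Band 0 (2 * c) 0 1
  tval-band₁ _ m≤2c rewrite ≤ᵇ-true m≤2c = refl

  tval-band₂ : Band (2 * c) (4 * c) 2 3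
  tval-band₂ 2c<m m≤4c rewrite ≤ᵇ-false 2c<m | ≤ᵇ-true m≤4c = refl

  tval-band₃ : Band (4 * c + 1) (6 * c) 5 4
  tval-band₃ 4c+1<m m≤6c
    rewrite ≤ᵇ-false (above 2 4 _ (<-trans 4c<4c+1 4c+1<m)) | ≤ᵇ-false (<-trans 4c<4c+1 4c+1<m)
          | ≡ᵇ-false (>⇒≢ 4c+1<m) | ≤ᵇ-true m≤6c = refl

  tval-band₄ : Band (6 * c) (8 * c) 3 2
  tval-band₄ 6c<m m≤8c
    rewrite ≤ᵇ-false (above 2 6 _ 6c<m) | ≤ᵇ-false (above 4 6 _ 6c<m)
          | ≡ᵇ-false (>⇒≢ (≤-<-trans 4c+1≤6c 6c<m)) | ≤ᵇ-false 6c<m | ≤ᵇ-true m≤8c = refl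

  tval-band₅ : Band (8 * c) (10 * c) 4 5
  tval-band₅ 8c<m m≤10c
    rewrite ≤ᵇ-false (above 2 8 _ 8c<m) | ≤ᵇ-false (above 4 8 _ 8c<m)
          | ≡ᵇ-false (>⇒≢ (≤-<-trans 4c+1≤6c (above 6 8 _ 8c<m))) | ≤ᵇ-false (above 6 8 _ 8c<m)
          | ≤ᵇ-false 8c<m | ≤ᵇ-true m≤10c = refl

  tval-above-10c : ∀ {m} → 10 * c < m → tval c m ≡ oe m 6 7
  tval-above-10c 10c<m
    rewrite ≤ᵇ-false (above 2 10 _ 10c<m) | ≤ᵇ-false (above 4 10 _ 10c<m)
          | ≡ᵇ-false (>⇒≢ (≤-<-trans 4c+1≤6c (above 6 10 _ 10c<m))) | ≤ᵇ-false (above 6 10 _ 10c<m)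
          | ≤ᵇ-false (above 8 10 _ 10c<m) | ≤ᵇ-false 10c<m = refl

  band-step : ∀ {lo hi a b m} → Band lo hi a b → Sibling a b → lo < m → m < hi →
    Sibling (tval c (suc m)) (tval c m)
  band-step {m = m} band sib lo<m m<hi =
    subst₂ Sibling (sym (band (<-trans lo<m (n<1+n m)) m<hi)) (sym (band lo<m (<⇒≤ m<hi))) (oe-step m sib)

  TvalStep : ℕ → Set
  TvalStep m = (∃ λ j → m ≡ j * (2 * c)) ⊎ m ≡ 4 * c + 1 ⊎ Sibling (tval c (suc m)) (tval c m)

  private
    -- For a numeral j, j * 2 * c reduces to the threshold (2j) * c compared against below.
    at-multiple : ∀ {m} j → m ≡ j * 2 * c → TvalStep m
    at-multiple j m≡ = inj₁ (j , trans m≡ (*-assoc j 2 c))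

    tval-step-above-4c+1 : ∀ {m} → 4 * c + 1 < m → m < 12 * c → TvalStep m
    tval-step-above-4c+1 {m} 4c+1<m m<12c with <-cmp m (6 * c)
    ... | tri< m<6c _ _ = inj₂ (inj₂ (band-step tval-band₃ (odd-even 2) 4c+1<m m<6c))
    ... | tri≈ _ m≡6c _ = at-multiple 3 m≡6c
    ... | tri> _ _ 6c<m with <-cmp m (8 * c)
    ...   | tri< m<8c _ _ = inj₂ (inj₂ (band-step tval-band₄ (odd-even 1) 6c<m m<8c))
    ...   | tri≈ _ m≡8c _ = at-multiple 4 m≡8c
    ...   | tri> _ _ 8c<m with <-cmp m (10 * c)
    ...     | tri< m<10c _ _ = inj₂ (inj₂ (band-step tval-band₅ (even-odd 2) 8c<m m<10c))
    ...     | tri≈ _ m≡10c _ = at-multiple 5 m≡10c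
    ...     | tri> _ _ 10c<m =
      inj₂ (inj₂ (band-step (λ 10c<k _ → tval-above-10c 10c<k) (even-odd 3) 10c<m m<12c))

  tval-step : ∀ {m} → 1 ≤ m → m < 12 * c → TvalStep m
  tval-step {m} 1≤m m<12c with <-cmp m (2 * c)
  ... | tri< m<2c _ _ = inj₂ (inj₂ (band-step tval-band₁ (even-odd 0) 1≤m m<2c))
  ... | tri≈ _ m≡2c _ = at-multiple 1 m≡2c
  ... | tri> _ _ 2c<m with <-cmp m (4 * c)
  ...   | tri< m<4c _ _ = inj₂ (inj₂ (band-step tval-band₂ (even-odd 1) 2c<m m<4c))
  ...   | tri≈ _ m≡4c _ = at-multiple 2 m≡4c
  ...   | tri> _ _ 4c<m with m ≟ 4 * c + 1
  ...     | yes m≡4c+1 = inj₂ (inj₁ m≡4c+1)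
  ...     | no m≢4c+1 = tval-step-above-4c+1 4c+1<m m<12c
    where
    4c+1<m : 4 * c + 1 < m
    4c+1<m = ≤∧≢⇒< (subst (_≤ m) (+-comm 1 (4 * c)) 4c<m) (≢-sym m≢4c+1)

s-unfold : ∀ {c} → 1 ≤ c → ∀ q r → r < 12 * c → s c (suc (r + q * (12 * c))) ≡ 8 * q + tval c (suc r)
s-unfold {c@(suc _)} _ q r r<N = cong₂ (λ q′ m → 8 * q′ + tval c m) quotient remainder
  where
  open ≡-Reasoning
  N : ℕ
  N = 12 * c
  quotient : (r + q * N) / N ≡ q
  quotient = begin
    (r + q * N) / N        ≡⟨ +-distrib-/-∣ʳ r (divides-refl q) ⟩
    r / N + q * N / N      ≡⟨ cong₂ _+_ (m<n⇒m/n≡0 r<N) (m*n/n≡m q N) ⟩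
    q                      ∎
  remainder : (r + q * N) % N + 1 ≡ suc r
  remainder = begin
    (r + q * N) % N + 1    ≡⟨ cong (_+ 1) ([m+kn]%n≡m%n r q N) ⟩
    r % N + 1              ≡⟨ cong (_+ 1) (m<n⇒m%n≡m r<N) ⟩
    r + 1                  ≡⟨ +-comm r 1 ⟩
    suc r                  ∎

multiple-of-2c : ∀ j q c → j * (2 * c) + q * (12 * c) ≡ (j + q * 6) * (2 * c)
multiple-of-2c = solve-∀

s-step : ∀ {c y} → 1 ≤ c → 1 ≤ y → IsOutnumber c y ⊎ Sibling (s c (suc y)) (s c y)
s-step {c@(suc _)} {suc z} 1≤c _ =
  subst (λ y → IsOutnumber c y ⊎ Sibling (s c (suc y)) (s c y))
        (sym (cong suc (m≡m%n+[m/n]*n z N)))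
        (step (z / N) (z % N) (m%n<n z N))
  where
  N : ℕ
  N = 12 * c
  shift-8* : ∀ q {a b} → Sibling a b → Sibling (8 * q + a) (8 * q + b)
  shift-8* q {a} {b} sib = subst (λ e → Sibling (e + a) (e + b)) (sym (*-assoc 2 4 q)) (Sibling-shift (4 * q) sib)
  outnumber-at : ∀ {r} q j → suc r ≡ j * (2 * c) → IsOutnumber c (suc r + q * N)
  outnumber-at q j 1+r≡ = s≤s z≤n , inj₁ (j + q * 6 , trans (cong (_+ q * N) 1+r≡) (multiple-of-2c j q c))
  step : ∀ q r → r < N →
    IsOutnumber c (suc r + q * N) ⊎ Sibling (s c (suc (suc r + q * N))) (s c (suc r + q * N))
  step q r r<N with m≤n⇒m<n∨m≡n r<N
  ... | inj₂ 1+r≡N = inj₁ (outnumber-at q 6 (trans 1+r≡N (*-assoc 6 2 c)))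
  ... | inj₁ 1+r<N with tval-step 1≤c (s≤s z≤n) 1+r<N
  ...   | inj₁ (j , 1+r≡) = inj₁ (outnumber-at q j 1+r≡)
  ...   | inj₂ (inj₁ 1+r≡4c+1) = inj₁ (s≤s z≤n , inj₂ (q , trans (cong (_+ q * N) 1+r≡4c+1) (+-comm _ (q * N))))
  ...   | inj₂ (inj₂ sib) =
    inj₂ (subst₂ Sibling (sym (s-unfold 1≤c q (suc r) 1+r<N)) (sym (s-unfold 1≤c q r r<N)) (shift-8* q sib))

outnumber⇒suc-innumber : ∀ {c y} → IsOutnumber c y → IsInnumber c (suc y)
outnumber⇒suc-innumber {c} (_ , inj₁ (k , y≡)) = s≤s z≤n , inj₁ (k , trans (cong suc y≡) (+-comm 1 (k * (2 * c))))
outnumber⇒suc-innumber {c} (_ , inj₂ (k , y≡)) = s≤s z≤n , inj₂ (k , trans (cong suc y≡) (suc-shift k c))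
  where
  suc-shift : ∀ k c → suc (k * (12 * c) + (4 * c + 1)) ≡ k * (12 * c) + (4 * c + 2)
  suc-shift = solve-∀

All-⊎∧¬All⇒Any : ∀ {A : Set} {P Q : A → Set} {n} {xs : Vec A n} →
  All (λ x → P x ⊎ Q x) xs → ¬ All P xs → Any Q xs
All-⊎∧¬All⇒Any []             ¬all = ⊥-elim (¬all [])
All-⊎∧¬All⇒Any (inj₁ px ∷ pqs) ¬all = there (All-⊎∧¬All⇒Any pqs (λ all → ¬all (px ∷ all)))
All-⊎∧¬All⇒Any (inj₂ qx ∷ _)   _    = here qx

entry≤sum : ∀ {p} (v : Vec ℕ p) → All (_≤ sum v) v
entry≤sum []      = []
entry≤sum (x ∷ v) = m≤m+n x (sum v) ∷ All.map (λ y≤ → ≤-trans y≤ (m≤n+m (sum v) x)) (entry≤sum v)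

entry<sum : ∀ {p} (v : Vec ℕ p) → 2 ≤ p → All (1 ≤_) v → All (_< sum v) v
entry<sum []          ()
entry<sum (_ ∷ [])    (s≤s ())
entry<sum (x ∷ y ∷ v) _ (1≤x ∷ 1≤y ∷ _) =
  m<m+n x (≤-trans 1≤y (m≤m+n y (sum v))) ∷ All.map (+-mono-≤ 1≤x) (entry≤sum (y ∷ v))

parts-bounded : ∀ {m p} {h : Vec ℕ p} → IsPartition m p h → 2 ≤ p → All (λ x → 1 ≤ x × x < m) h
parts-bounded {h = h} (pos , refl) 2≤p = All.zip (pos , entry<sum h 2≤p pos)

module _ (g : ℕ → ℕ) where

  Decrementable : ℕ → Set
  Decrementable x = Σ ℕ λ x′ → x ≡ suc x′ × 1 ≤ x′ × Sibling (g x) (g x′)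

  Incrementable : ℕ → Set
  Incrementable x = Sibling (g (suc x)) (g x)

  decrement-part : ∀ {p} {h : Vec ℕ p} → All (1 ≤_) h → Any Decrementable h →
    Σ (Vec ℕ p) λ h′ → All (1 ≤_) h′ × suc (sum h′) ≡ sum h × Sibling (nimVal g h) (nimVal g h′)
  decrement-part {h = _ ∷ h} (_ ∷ pos) (here (x′ , refl , 1≤x′ , sib)) =
    x′ ∷ h , 1≤x′ ∷ pos , refl , ⊕-siblingˡ (nimVal g h) sib
  decrement-part {h = x ∷ _} (1≤x ∷ pos) (there any) with decrement-part pos any
  ... | h′ , pos′ , 1+Σh′≡Σh , sib =
    x ∷ h′ , 1≤x ∷ pos′ , trans (sym (+-suc x (sum h′))) (cong (x +_) 1+Σh′≡Σh) , ⊕-siblingʳ (g x) sib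

  increment-part : ∀ {p} {h : Vec ℕ p} → All (1 ≤_) h → Any Incrementable h →
    Σ (Vec ℕ p) λ h′ → All (1 ≤_) h′ × sum h′ ≡ suc (sum h) × Sibling (nimVal g h′) (nimVal g h)
  increment-part {h = x ∷ h} (_ ∷ pos) (here sib) =
    suc x ∷ h , s≤s z≤n ∷ pos , refl , ⊕-siblingˡ (nimVal g h) sib
  increment-part {h = x ∷ h} (1≤x ∷ pos) (there any) with increment-part pos any
  ... | h′ , pos′ , Σh′≡1+Σh , sib =
    x ∷ h′ , 1≤x ∷ pos′ , trans (cong (x +_) Σh′≡1+Σh) (+-suc x (sum h)) , ⊕-siblingʳ (g x) sib

module _ {c : ℕ} (1≤c : 1 ≤ c) {g : ℕ → ℕ} {n : ℕ} (g≡s : ∀ m → 1 ≤ m → m ≤ n → g m ≡ s c m) where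

  private
    sibling-below : ∀ {y} → 1 ≤ y → suc y ≤ n → Sibling (s c (suc y)) (s c y) → Sibling (g (suc y)) (g y)
    sibling-below 1≤y 1+y≤n =
      subst₂ Sibling (sym (g≡s _ (s≤s z≤n) 1+y≤n)) (sym (g≡s _ 1≤y (≤-trans (n≤1+n _) 1+y≤n)))

  innumber-or-decrementable : ∀ {x} → 1 ≤ x → x ≤ n → IsInnumber c x ⊎ Decrementable g x
  innumber-or-decrementable {1} _ _ = inj₁ (s≤s z≤n , inj₁ (0 , refl))
  innumber-or-decrementable {suc (suc y)} _ x≤n =
    ⊎-map (outnumber⇒suc-innumber {c}) (λ sib → suc y , refl , s≤s z≤n , sibling-below (s≤s z≤n) x≤n sib)
          (s-step 1≤c (s≤s z≤n))

  outnumber-or-incrementable : ∀ {y} → 1 ≤ y → y < n → IsOutnumber c y ⊎ Incrementable g y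
  outnumber-or-incrementable 1≤y y<n = ⊎-map₂ (sibling-below 1≤y y<n) (s-step 1≤c 1≤y)

  lower-part : ∀ {p} {h : Vec ℕ p} → 2 ≤ p → IsPartition (suc n) p h → ¬ IsEntering c h →
    Σ (Vec ℕ p) λ h′ → IsPartition n p h′ × nimVal g h ≡ nimVal g h′ ⊕ 1
  lower-part {h = h} 2≤p part@(pos , Σh≡1+n) ¬entering
    with decrement-part g pos (All-⊎∧¬All⇒Any classified ¬entering)
    where
    classified : All (λ x → IsInnumber c x ⊎ Decrementable g x) h
    classified = All.map (λ (1≤x , x<1+n) → innumber-or-decrementable 1≤x (≤-pred x<1+n))
                         (parts-bounded part 2≤p)
  ... | h′ , pos′ , 1+Σh′≡Σh , sib = h′ , (pos′ , suc-injective (trans 1+Σh′≡Σh Σh≡1+n)) , Sibling⇒≡⊕1 sib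

  raise-part : ∀ {p} {j : Vec ℕ p} → 2 ≤ p → IsPartition n p j → ¬ IsExiting c j →
    Σ (Vec ℕ p) λ j′ → IsPartition (suc n) p j′ × nimVal g j′ ≡ nimVal g j ⊕ 1
  raise-part {j = j} 2≤p part@(pos , Σj≡n) ¬exiting
    with increment-part g pos (All-⊎∧¬All⇒Any classified ¬exiting)
    where
    classified : All (λ y → IsOutnumber c y ⊎ Incrementable g y) j
    classified = All.map (λ (1≤y , y<n) → outnumber-or-incrementable 1≤y y<n) (parts-bounded part 2≤p)
  ... | j′ , pos′ , Σj′≡1+Σj , sib = j′ , (pos′ , trans Σj′≡1+Σj (cong suc Σj≡n)) , Sibling⇒≡⊕1 sib

lemma1 : (c : ℕ) → 2 ≤ c → (g : ℕ → ℕ) → IsNimSeq c g →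
    (n : ℕ) → 1 ≤ n → (∀ m → 1 ≤ m → m ≤ n → g m ≡ s c m) →
    (p : ℕ) → 2 ≤ p →
    ((h : Vec ℕ p) → IsPartition (ℕ.suc n) p h → ¬ IsEntering c h →
    Σ (Vec ℕ p) λ h′ → IsPartition n p h′ × nimVal g h ≡ nimVal g h′ ⊕ 1)
    × ((j : Vec ℕ p) → IsPartition n p j → ¬ IsExiting c j →
    Σ (Vec ℕ p) λ j′ → IsPartition (ℕ.suc n) p j′ × nimVal g j′ ≡ nimVal g j ⊕ 1)
lemma1 c 2≤c g _ n _ g≡s p 2≤p =
  (λ h → lower-part 1≤c g≡s 2≤p) , (λ j → raise-part 1≤c g≡s 2≤p)
  where
  1≤c : 1 ≤ c
  1≤c = ≤-trans (s≤s z≤n) 2≤c
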